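{- Let $(\mathscr{A}_1,V_1)$ and $(\mathscr{A}_2,V_2)$ be central arrangements with $\dim V_1,\dim V_2>0$, and let $i,j\geq0$. Then $SD^{(i)}(\mathscr{A}_1)D^{(j)}(\mathscr{A}_2)\subseteq D^{(i+j)}(\mathscr{A}_1\times\mathscr{A}_2)$.
   Context: $\mathbb{K}$ is a field of characteristic zero. For an arrangement $\mathscr{A}$ in an $\ell$-dimensional space $V$ with $S=\mathrm{Sym}(V^*)=\mathbb{K}[x_1,\dots,x_\ell]$, defining polynomial $Q=\prod_{H\in\mathscr{A}}\alpha_H$ ($\ker\alpha_H=H$), let $D^{(m)}(S)=\bigoplus_{|\bm a|=m}S\partial^{\bm a}\subseteq\mathrm{End}_{\mathbb{K}}(S)$ for $m\geq1$, $D^{(0)}(S)=S$ (multiplication operators), and $D^{(m)}(\mathscr{A})=\{\theta\in D^{(m)}(S)\mid\theta(QS)\subseteq QS\}$ (so $D^{(0)}(\mathscr{A})=S$). Let $S_1=\mathrm{Sym}(V_1^*)=\mathbb{K}[x_1,\dots,x_{\ell_1}]$, $S_2=\mathrm{Sym}(V_2^*)=\mathbb{K}[y_1,\dots,y_{\ell_2}]$, $Q_1=Q(\mathscr{A}_1)\in S_1$, $Q_2=Q(\mathscr{A}_2)\in S_2$, and $S=S_1\otimes S_2=\mathbb{K}[x_1,\dots,x_{\ell_1},y_1,\dots,y_{\ell_2}]$. The product arrangement $\mathscr{A}_1\times\mathscr{A}_2=\{H\oplus V_2\mid H\in\mathscr{A}_1\}\cup\{V_1\oplus H\mid H\in\mathscr{A}_2\}$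 in $V_1\oplus V_2$ has defining polynomial $Q_1Q_2\in S$. Operators in $D^{(i)}(S_1)$ (polynomial coefficients in $S_1$, partial derivatives in the $x$'s) and in $D^{(j)}(S_2)$ (coefficients in $S_2$, derivatives in the $y$'s) are regarded as elements of $\mathrm{End}_{\mathbb{K}}(S)$ by the same formulas; such operators commute. For subsets $M_1\subseteq D^{(i)}(S_1)$, $M_2\subseteq D^{(j)}(S_2)$, $SM_1M_2$ denotes the $S$-submodule of $\mathrm{End}_{\mathbb{K}}(S)$ generated by all products $\theta\eta$ with $\theta\in M_1$, $\eta\in M_2$. -}

module Defs where

open import Level using (Level; _⊔_) renaming (suc to lsuc)
open import Data.Nat as ℕ using (ℕ; zero; suc; _∸_)
open import Data.Fin using (Fin)
open import Data.Vec as Vec using (Vec; []; _∷_; _++_; replicate; lookup; updateAt; zipWith)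
open import Data.Vec.Properties using (≡-dec)
open import Data.List as List using (List; []; _∷_; concatMap; foldr)
open import Data.List.Relation.Unary.All using (All)
open import Data.Product using (Σ; ∃; _×_; _,_)
open import Relation.Binary.PropositionalEquality using (_≡_)
open import Relation.Nullary using (¬_; yes; no)
open import Algebra.Bundles using (CommutativeRing)

record Field (c ℓ : Level) : Set (lsuc (c ⊔ ℓ)) where
  field
    commutativeRing : CommutativeRing c ℓ
  open CommutativeRing commutativeRing public
  field
    1≉0     : ¬ (1# ≈ 0#)
    inverse : ∀ x → ¬ (x ≈ 0#) → Σ Carrier (λ y → (x * y) ≈ 1#)

module FieldTheory {c ℓ : Level} (K : Field c ℓ) where
  open Field K using (Carrier; _≈_; _+_; _*_; 0#; 1#)

  ι : ℕ → Carrier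
  ι zero    = 0#
  ι (suc n) = 1# + ι n

  CharZero : Set ℓ
  CharZero = ∀ n → ι n ≈ 0# → n ≡ zero

  -- Polynomials in n variables: formal finite sums of terms c·x^e.
  -- Equality is coefficientwise (setoid equality).

  Mono : ℕ → Set
  Mono n = Vec ℕ n

  Poly : ℕ → Set c
  Poly n = List (Carrier × Mono n)

  coeff : ∀ {n} → Poly n → Mono n → Carrier
  coeff []             m = 0#
  coeff ((a , e) ∷ p) m with ≡-dec ℕ._≟_ e m
  ... | yes _ = a + coeff p m
  ... | no  _ = coeff p m

  _≈P_ : ∀ {n} → Poly n → Poly n → Set ℓ
  p ≈P q = ∀ m → coeff p m ≈ coeff q m

  _+P_ : ∀ {n} → Poly n → Poly n → Poly n
  p +P q = p List.++ q

  0P : ∀ {n} → Poly n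
  0P = []

  _*P_ : ∀ {n} → Poly n → Poly n → Poly n
  p *P q = concatMap (λ { (a , e) → List.map (λ { (b , f) → (a * b , zipWith ℕ._+_ e f) }) q }) p

  1P : ∀ {n} → Poly n
  1P = (1# , replicate _ 0) ∷ []

  sumP : ∀ {n} → List (Poly n) → Poly n
  sumP = foldr _+P_ 0P

  prodP : ∀ {n} → List (Poly n) → Poly n
  prodP = foldr _*P_ 1P

  _∣P_ : ∀ {n} → Poly n → Poly n → Set (c ⊔ ℓ)
  q ∣P p = Σ (Poly _) (λ g → p ≈P (q *P g))

  ∂ : ∀ {n} → Fin n → Poly n → Poly n
  ∂ k = List.map (λ { (a , e) → (ι (lookup e k) * a , updateAt e k (λ t → t ∸ 1)) })

  iter : ∀ {a} {A : Set a} → ℕ → (A → A) → A → A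
  iter zero    f x = x
  iter (suc r) f x = f (iter r f x)

  -- ∂^a = ∂_1^{a_1} ⋯ ∂_n^{a_n}
  ∂^ : ∀ {n} → Vec ℕ n → Poly n → Poly n
  ∂^ a f = Vec.foldr (λ _ → Poly _) (λ {(k , r) g → iter r (∂ k) g}) f
             (Vec.zip (Vec.allFin _) a)

  -- Differential operators Σ p_a ∂^a (formal finite sums) and their action

  Op : ℕ → Set c
  Op n = List (Poly n × Vec ℕ n)

  act : ∀ {n} → Op n → Poly n → Poly n
  act θ f = sumP (List.map (λ { (p , a) → p *P ∂^ a f }) θ)

  ∣_∣ : ∀ {n} → Vec ℕ n → ℕ
  ∣ a ∣ = Vec.sum a

  -- θ ∈ D^{(m)}(S) = ⊕_{|a|=m} S ∂^a   (for m = 0 this is S)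
  IsOrder : ∀ {n} → ℕ → Op n → Set c
  IsOrder m θ = All (λ { (_ , a) → ∣ a ∣ ≡ m }) θ

  LinForm : ℕ → Set c
  LinForm n = Vec Carrier n

  NonZeroForm : ∀ {n} → LinForm n → Set ℓ
  NonZeroForm α = ¬ (∀ k → lookup α k ≈ 0#)

  Proportional : ∀ {n} → LinForm n → LinForm n → Set (c ⊔ ℓ)
  Proportional α β = Σ Carrier (λ t → ∀ k → lookup α k ≈ (t * lookup β k))

  data Distinct {n} : List (LinForm n) → Set (c ⊔ ℓ) where
    []  : Distinct []
    _∷_ : ∀ {α αs} → All (λ β → ¬ Proportional α β) αs → Distinct αs → Distinct (α ∷ αs)

  record Arrangement (n : ℕ) : Set (c ⊔ ℓ) where
    field
      forms    : List (LinForm n)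
      nonzero  : All NonZeroForm forms
      distinct : Distinct forms
  open Arrangement public

  unitVec : ∀ {n} → Fin n → Mono n
  unitVec k = updateAt (replicate _ 0) k (λ _ → 1)

  linPoly : ∀ {n} → LinForm n → Poly n
  linPoly α = List.map (λ k → (lookup α k , unitVec k)) (List.allFin _)

  Q : ∀ {n} → List (LinForm n) → Poly n
  Q αs = prodP (List.map linPoly αs)

  InD : ∀ {n} → ℕ → List (LinForm n) → Op n → Set (c ⊔ ℓ)
  InD m αs θ = IsOrder m θ × (∀ g → Q αs ∣P act θ (Q αs *P g))

  -- Products: S = S₁ ⊗ S₂ = K[x₁..x_{ℓ₁}, y₁..y_{ℓ₂}]

  embL : ∀ {n₁} n₂ → Poly n₁ → Poly (n₁ ℕ.+ n₂)
  embL n₂ = List.map (λ { (a , e) → (a , e ++ replicate n₂ 0) })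

  embR : ∀ n₁ {n₂} → Poly n₂ → Poly (n₁ ℕ.+ n₂)
  embR n₁ = List.map (λ { (a , e) → (a , replicate n₁ 0 ++ e) })

  opL : ∀ {n₁} n₂ → Op n₁ → Op (n₁ ℕ.+ n₂)
  opL n₂ = List.map (λ { (p , a) → (embL n₂ p , a ++ replicate n₂ 0) })

  opR : ∀ n₁ {n₂} → Op n₂ → Op (n₁ ℕ.+ n₂)
  opR n₁ = List.map (λ { (p , a) → (embR n₁ p , replicate n₁ 0 ++ a) })

  -- A₁ × A₂ = {H ⊕ V₂} ∪ {V₁ ⊕ H}
  formsProd : ∀ {n₁ n₂} → List (LinForm n₁) → List (LinForm n₂) → List (LinForm (n₁ ℕ.+ n₂))
  formsProd {n₁} {n₂} αs βs =
    List.map (λ α → α ++ replicate n₂ 0#) αs List.++ List.map (λ β → replicate n₁ 0# ++ β) βs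

-- An operator θ ∈ D(A₁) involves only the x-variables and η ∈ D(A₂) only the y-variables, so
-- θη acts factorwise on a product of an x-polynomial and a y-polynomial:
-- θη(Q₁A · Q₂B) = θ(Q₁A) · η(Q₂B) ∈ Q₁Q₂S.  Every polynomial of S is a sum of such products
-- (its monomials xᵘyᵛ) and θη is additive, so θη(Q₁Q₂S) ⊆ Q₁Q₂S, and Q₁Q₂ is the defining
-- polynomial of A₁ × A₂.  Writing θ = Σ p_a ∂^a and η = Σ q_b ∂^b, the composite θη is the
-- operator Σ p_a q_b ∂^(a,b) of order i + j, and multiplying by f ∈ S keeps all of this.
module Submission where

open import Defs
open import Level using (Level; _⊔_)
open import Data.List as List using (List; map; []; _∷_; _++_; concat; concatMap)
open import Data.List.Relation.Unary.All as All using (All; []; _∷_)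
open import Data.Product using (Σ; _×_; _,_; proj₂)

open import Algebra.Bundles using (CommutativeSemigroup)
import Algebra.Properties.CommutativeSemigroup as CommutativeSemigroupProperties
open import Data.Empty using (⊥-elim)
open import Data.Fin as Fin using (Fin; _↑ˡ_; _↑ʳ_)
import Data.List.Properties as Listₚ
open import Data.List.Relation.Binary.Pointwise as Pointwise using ([]; _∷_)
import Data.List.Relation.Unary.All.Properties as Allₚ
open import Data.Nat as ℕ using (ℕ; zero; suc; _∸_)
import Data.Nat.Properties as ℕₚ
import Data.Product.Relation.Binary.Pointwise.NonDependent as ×
open import Data.Vec as Vec using (Vec; []; _∷_; replicate; lookup; updateAt; zipWith)
import Data.Vec.Properties as Vecₚ
open import Function using (id; _∘_)
open import Relation.Binary.Bundles using (Setoid)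
open import Relation.Binary.Structures using (IsEquivalence)
import Relation.Binary.Reasoning.Setoid as SetoidReasoning
open import Relation.Binary.PropositionalEquality as ≡ using (_≡_; _≢_; cong; cong₂)
open import Relation.Nullary using (yes; no)

infixl 6 _+ᵐ_

_+ᵐ_ : ∀ {n} → Vec ℕ n → Vec ℕ n → Vec ℕ n
_+ᵐ_ = zipWith ℕ._+_

+ᵐ-assoc : ∀ {n} (e f g : Vec ℕ n) → (e +ᵐ f) +ᵐ g ≡ e +ᵐ (f +ᵐ g)
+ᵐ-assoc = Vecₚ.zipWith-assoc ℕₚ.+-assoc

+ᵐ-comm : ∀ {n} (e f : Vec ℕ n) → e +ᵐ f ≡ f +ᵐ e
+ᵐ-comm = Vecₚ.zipWith-comm ℕₚ.+-comm

+ᵐ-identityˡ : ∀ {n} (e : Vec ℕ n) → replicate n 0 +ᵐ e ≡ e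
+ᵐ-identityˡ = Vecₚ.zipWith-identityˡ ℕₚ.+-identityˡ

+ᵐ-identityʳ : ∀ {n} (e : Vec ℕ n) → e +ᵐ replicate n 0 ≡ e
+ᵐ-identityʳ = Vecₚ.zipWith-identityʳ ℕₚ.+-identityʳ

m+ᵐn∸ᵐm≡n : ∀ {n} (e f : Vec ℕ n) → zipWith _∸_ (e +ᵐ f) e ≡ f
m+ᵐn∸ᵐm≡n []      []      = ≡.refl
m+ᵐn∸ᵐm≡n (x ∷ e) (y ∷ f) = cong₂ _∷_ (ℕₚ.m+n∸m≡n x y) (m+ᵐn∸ᵐm≡n e f)

+ᵐ-++ : ∀ {m n} (e : Vec ℕ m) (f : Vec ℕ n) (e′ : Vec ℕ m) (f′ : Vec ℕ n) →
        (e Vec.++ f) +ᵐ (e′ Vec.++ f′) ≡ (e +ᵐ e′) Vec.++ (f +ᵐ f′)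
+ᵐ-++ = Vecₚ.zipWith-++ ℕ._+_

updateAt-+ᵐ : ∀ {n} (e f : Vec ℕ n) (k : Fin n) (g : ℕ → ℕ) → lookup e k ≡ 0 →
              updateAt (e +ᵐ f) k g ≡ e +ᵐ updateAt f k g
updateAt-+ᵐ (x ∷ e) (y ∷ f) Fin.zero    g ≡.refl = ≡.refl
updateAt-+ᵐ (x ∷ e) (y ∷ f) (Fin.suc k) g eₖ≡0  = cong (x ℕ.+ y ∷_) (updateAt-+ᵐ e f k g eₖ≡0)

replicate-+ : ∀ {a} {A : Set a} m n (x : A) → replicate (m ℕ.+ n) x ≡ replicate m x Vec.++ replicate n x
replicate-+ zero    n x = ≡.refl
replicate-+ (suc m) n x = cong (x ∷_) (replicate-+ m n x)

updateAt-↑ˡ : ∀ {a} {A : Set a} {m n} (u : Vec A m) (v : Vec A n) (i : Fin m) (g : A → A) →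
              updateAt (u Vec.++ v) (i ↑ˡ n) g ≡ updateAt u i g Vec.++ v
updateAt-↑ˡ (x ∷ u) v Fin.zero    g = ≡.refl
updateAt-↑ˡ (x ∷ u) v (Fin.suc i) g = cong (x ∷_) (updateAt-↑ˡ u v i g)

updateAt-↑ʳ : ∀ {a} {A : Set a} {m n} (u : Vec A m) (v : Vec A n) (i : Fin n) (g : A → A) →
              updateAt (u Vec.++ v) (m ↑ʳ i) g ≡ u Vec.++ updateAt v i g
updateAt-↑ʳ []      v i g = ≡.refl
updateAt-↑ʳ (x ∷ u) v i g = cong (x ∷_) (updateAt-↑ʳ u v i g)

take-++ : ∀ {a} {A : Set a} {m n} (u : Vec A m) (v : Vec A n) → Vec.take m (u Vec.++ v) ≡ u
take-++ {m = m} u v = Vecₚ.++-injectiveˡ _ u (Vecₚ.take++drop≡id m (u Vec.++ v))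

drop-++ : ∀ {a} {A : Set a} {m n} (u : Vec A m) (v : Vec A n) → Vec.drop m (u Vec.++ v) ≡ v
drop-++ {m = m} u v = Vecₚ.++-injectiveʳ _ u (Vecₚ.take++drop≡id m (u Vec.++ v))

Vec-tabulate-+ : ∀ {a} {A : Set a} m {n} (g : Fin (m ℕ.+ n) → A) →
                 Vec.tabulate g ≡ Vec.tabulate (g ∘ (_↑ˡ n)) Vec.++ Vec.tabulate (g ∘ (m ↑ʳ_))
Vec-tabulate-+ zero    g = ≡.refl
Vec-tabulate-+ (suc m) g = cong (g Fin.zero ∷_) (Vec-tabulate-+ m (g ∘ Fin.suc))

List-tabulate-+ : ∀ {a} {A : Set a} m {n} (g : Fin (m ℕ.+ n) → A) →
                  List.tabulate g ≡ List.tabulate (g ∘ (_↑ˡ n)) ++ List.tabulate (g ∘ (m ↑ʳ_))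
List-tabulate-+ zero    g = ≡.refl
List-tabulate-+ (suc m) g = cong (g Fin.zero ∷_) (List-tabulate-+ m (g ∘ Fin.suc))

allFin-+ : ∀ m n → List.allFin (m ℕ.+ n) ≡ map (_↑ˡ n) (List.allFin m) ++ map (m ↑ʳ_) (List.allFin n)
allFin-+ m n = ≡.trans (List-tabulate-+ m id)
  (cong₂ _++_ (≡.sym (Listₚ.map-tabulate id (_↑ˡ n))) (≡.sym (Listₚ.map-tabulate id (m ↑ʳ_))))

map-∘-commute : ∀ {a b b′ d} {A : Set a} {B : Set b} {B′ : Set b′} {D : Set d}
                {f : A → B} {g : B → D} {f′ : A → B′} {g′ : B′ → D} →
                (∀ x → g (f x) ≡ g′ (f′ x)) → ∀ xs → map g (map f xs) ≡ map g′ (map f′ xs)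
map-∘-commute g∘f≗g′∘f′ xs =
  ≡.trans (≡.sym (Listₚ.map-∘ xs)) (≡.trans (Listₚ.map-cong g∘f≗g′∘f′ xs) (Listₚ.map-∘ xs))

module PolynomialAlgebra {c ℓ : Level} (K : Field c ℓ) where
  open Field K renaming (refl to ≈-refl; sym to ≈-sym; trans to ≈-trans)
  open FieldTheory K

  private variable
    n N : ℕ

  infix 4 _≋_

  -- _≈P_ and _∣P_ unfold to Π- and Σ-types from which Agda cannot infer the polynomials involved;
  -- the records _≋_ and _∣_ (below) keep them recoverable.
  record _≋_ (p q : Poly n) : Set ℓ where
    constructor mk≋
    field coeff-≈ : p ≈P q
  open _≋_ public

  ≋-isEquivalence : IsEquivalence (_≋_ {n})
  ≋-isEquivalence = record
    { refl  = mk≋ λ _ → ≈-refl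
    ; sym   = λ (mk≋ p≈q) → mk≋ λ m → ≈-sym (p≈q m)
    ; trans = λ (mk≋ p≈q) (mk≋ q≈r) → mk≋ λ m → ≈-trans (p≈q m) (q≈r m)
    }

  ≋-setoid : ℕ → Setoid c ℓ
  ≋-setoid n = record { isEquivalence = ≋-isEquivalence {n} }

  module _ {n : ℕ} where
    open IsEquivalence (≋-isEquivalence {n}) public
      using () renaming (refl to ≋-refl; sym to ≋-sym; trans to ≋-trans; reflexive to ≡⇒≋)

  module ≋-Reasoning {n : ℕ} = SetoidReasoning (≋-setoid n)
  open ≋-Reasoning

  coeff-++ : (p q : Poly n) (m : Mono n) → coeff (p ++ q) m ≈ coeff p m + coeff q m
  coeff-++ []            q m = ≈-sym (+-identityˡ _)
  coeff-++ ((a , e) ∷ p) q m with Vecₚ.≡-dec ℕ._≟_ e m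
  ... | yes _ = ≈-trans (+-congˡ (coeff-++ p q m)) (≈-sym (+-assoc _ _ _))
  ... | no  _ = coeff-++ p q m

  ++-cong : {p p′ q q′ : Poly n} → p ≋ p′ → q ≋ q′ → p ++ q ≋ p′ ++ q′
  ++-cong {p = p} {p′} {q} {q′} (mk≋ p≈p′) (mk≋ q≈q′) = mk≋ λ m →
    ≈-trans (coeff-++ p q m) (≈-trans (+-cong (p≈p′ m) (q≈q′ m)) (≈-sym (coeff-++ p′ q′ m)))

  ++-comm : (p q : Poly n) → p ++ q ≋ q ++ p
  ++-comm p q = mk≋ λ m → ≈-trans (coeff-++ p q m) (≈-trans (+-comm _ _) (≈-sym (coeff-++ q p m)))

  ++-commutativeSemigroup : ℕ → CommutativeSemigroup c ℓ
  ++-commutativeSemigroup n = record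
    { Carrier = Poly n
    ; _≈_     = _≋_
    ; _∙_     = _++_
    ; isCommutativeSemigroup = record
      { isSemigroup = record
        { isMagma = record { isEquivalence = ≋-isEquivalence ; ∙-cong = ++-cong }
        ; assoc   = λ p q r → ≡⇒≋ (Listₚ.++-assoc p q r)
        }
      ; comm = ++-comm
      }
    }

  ++-interchange : (p q r s : Poly n) → (p ++ q) ++ (r ++ s) ≋ (p ++ r) ++ (q ++ s)
  ++-interchange = CommutativeSemigroupProperties.interchange (++-commutativeSemigroup _)

  Termwise : Poly n → Poly n → Set (c ⊔ ℓ)
  Termwise = Pointwise.Pointwise (×.Pointwise _≈_ _≡_)

  Termwise⇒≋ : {p q : Poly n} → Termwise p q → p ≋ q
  Termwise⇒≋ w = mk≋ (termwise w)
    where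
    termwise : {p q : Poly n} → Termwise p q → p ≈P q
    termwise [] m = ≈-refl
    termwise {p = (_ , e) ∷ _} ((a≈b , ≡.refl) ∷ w) m with Vecₚ.≡-dec ℕ._≟_ e m
    ... | yes _ = +-cong a≈b (termwise w m)
    ... | no  _ = termwise w m

  zero-coeffs⇒≋[] : {p : Poly n} → All (λ (a , _) → a ≈ 0#) p → p ≋ []
  zero-coeffs⇒≋[] zs = mk≋ (go zs)
    where
    go : {p : Poly n} → All (λ (a , _) → a ≈ 0#) p → p ≈P []
    go [] m = ≈-refl
    go {p = (_ , e) ∷ _} (a≈0 ∷ zs) m with Vecₚ.≡-dec ℕ._≟_ e m
    ... | yes _ = ≈-trans (+-cong a≈0 (go zs m)) (+-identityˡ _)
    ... | no  _ = go zs m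

  mapTerms : (Carrier → Carrier) → (Mono n → Mono N) → Poly n → Poly N
  mapTerms σ ε = map (λ (a , e) → (σ a , ε e))

  -- An exponent map with a left inverse is injective and its image is decidable, so each
  -- coefficient of the image polynomial is either σ of one coefficient or 0.
  module MapTerms (σ : Carrier → Carrier) (ε : Mono n → Mono N)
    (σ-cong : ∀ {x y} → x ≈ y → σ x ≈ σ y) (σ-0 : σ 0# ≈ 0#) (σ-+ : ∀ x y → σ (x + y) ≈ σ x + σ y)
    (π : Mono N → Mono n) (π∘ε : ∀ e → π (ε e) ≡ e)
    where

    coeff-mapTerms-image : (p : Poly n) (m : Mono N) → ε (π m) ≡ m →
                           coeff (mapTerms σ ε p) m ≈ σ (coeff p (π m))
    coeff-mapTerms-image []            m _   = ≈-sym σ-0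
    coeff-mapTerms-image ((a , e) ∷ p) m hit with Vecₚ.≡-dec ℕ._≟_ (ε e) m | Vecₚ.≡-dec ℕ._≟_ e (π m)
    ... | yes _     | yes _     = ≈-trans (+-congˡ (coeff-mapTerms-image p m hit)) (≈-sym (σ-+ a _))
    ... | yes εe≡m  | no  e≢πm  = ⊥-elim (e≢πm (≡.trans (≡.sym (π∘ε e)) (cong π εe≡m)))
    ... | no  εe≢m  | yes e≡πm  = ⊥-elim (εe≢m (≡.trans (cong ε e≡πm) hit))
    ... | no  _     | no  _     = coeff-mapTerms-image p m hit

    coeff-mapTerms-outside : (p : Poly n) (m : Mono N) → ε (π m) ≢ m → coeff (mapTerms σ ε p) m ≈ 0#
    coeff-mapTerms-outside []            m _    = ≈-refl
    coeff-mapTerms-outside ((a , e) ∷ p) m miss with Vecₚ.≡-dec ℕ._≟_ (ε e) m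
    ... | yes εe≡m = ⊥-elim (miss (≡.trans (cong (ε ∘ π) (≡.sym εe≡m)) (≡.trans (cong ε (π∘ε e)) εe≡m)))
    ... | no  _    = coeff-mapTerms-outside p m miss

    mapTerms-cong : {p q : Poly n} → p ≋ q → mapTerms σ ε p ≋ mapTerms σ ε q
    mapTerms-cong {p} {q} (mk≋ p≈q) = mk≋ image≈
      where
      image≈ : mapTerms σ ε p ≈P mapTerms σ ε q
      image≈ m with Vecₚ.≡-dec ℕ._≟_ (ε (π m)) m
      ... | yes hit  = ≈-trans (coeff-mapTerms-image p m hit)
                         (≈-trans (σ-cong (p≈q (π m))) (≈-sym (coeff-mapTerms-image q m hit)))
      ... | no  miss = ≈-trans (coeff-mapTerms-outside p m miss) (≈-sym (coeff-mapTerms-outside q m miss))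

  mulTerm : Carrier × Mono n → Poly n → Poly n
  mulTerm (a , e) = mapTerms (a *_) (e +ᵐ_)

  mulTerm-cong : (t : Carrier × Mono n) {q q′ : Poly n} → q ≋ q′ → mulTerm t q ≋ mulTerm t q′
  mulTerm-cong (a , e) =
    MapTerms.mapTerms-cong (a *_) (e +ᵐ_) *-congˡ (zeroʳ a) (distribˡ a) (λ m → zipWith _∸_ m e) (m+ᵐn∸ᵐm≡n e)

  mulTerm-++ : (t : Carrier × Mono n) (q q′ : Poly n) → mulTerm t (q ++ q′) ≡ mulTerm t q ++ mulTerm t q′
  mulTerm-++ t = Listₚ.map-++ _

  mulTerm-mulTerm : (a b : Carrier) (e f : Mono n) (r : Poly n) →
                    Termwise (mulTerm (a , e) (mulTerm (b , f) r)) (mulTerm (a * b , e +ᵐ f) r)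
  mulTerm-mulTerm a b e f []            = []
  mulTerm-mulTerm a b e f ((x , g) ∷ r) =
    (≈-sym (*-assoc a b x) , ≡.sym (+ᵐ-assoc e f g)) ∷ mulTerm-mulTerm a b e f r

  mulTerm-identity : (q : Poly n) → Termwise (mulTerm (1# , replicate n 0) q) q
  mulTerm-identity []            = []
  mulTerm-identity ((b , f) ∷ q) = (*-identityˡ b , +ᵐ-identityˡ f) ∷ mulTerm-identity q

  *P-++ˡ : (p p′ q : Poly n) → (p ++ p′) *P q ≡ p *P q ++ p′ *P q
  *P-++ˡ p p′ q = Listₚ.concatMap-++ _ p p′

  *P-[]ʳ : (p : Poly n) → p *P [] ≡ []
  *P-[]ʳ []      = ≡.refl
  *P-[]ʳ (_ ∷ p) = *P-[]ʳ p

  *P-++ʳ : (p q q′ : Poly n) → p *P (q ++ q′) ≋ p *P q ++ p *P q′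
  *P-++ʳ []      q q′ = ≋-refl
  *P-++ʳ (t ∷ p) q q′ = begin
    mulTerm t (q ++ q′) ++ p *P (q ++ q′)              ≈⟨ ++-cong (≡⇒≋ (mulTerm-++ t q q′)) (*P-++ʳ p q q′) ⟩
    (mulTerm t q ++ mulTerm t q′) ++ (p *P q ++ p *P q′) ≈⟨ ++-interchange (mulTerm t q) _ (p *P q) _ ⟩
    (mulTerm t q ++ p *P q) ++ (mulTerm t q′ ++ p *P q′) ∎

  mulTerm-*P : (t : Carrier × Mono n) (q r : Poly n) → mulTerm t (q *P r) ≋ mulTerm t q *P r
  mulTerm-*P t       []            r = ≋-refl
  mulTerm-*P (a , e) ((b , f) ∷ q) r = begin
    mulTerm (a , e) (mulTerm (b , f) r ++ q *P r)
      ≡⟨ mulTerm-++ (a , e) (mulTerm (b , f) r) (q *P r) ⟩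
    mulTerm (a , e) (mulTerm (b , f) r) ++ mulTerm (a , e) (q *P r)
      ≈⟨ ++-cong (Termwise⇒≋ (mulTerm-mulTerm a b e f r)) (mulTerm-*P (a , e) q r) ⟩
    mulTerm (a * b , e +ᵐ f) r ++ mulTerm (a , e) q *P r            ∎

  *P-assoc : (p q r : Poly n) → (p *P q) *P r ≋ p *P (q *P r)
  *P-assoc []      q r = ≋-refl
  *P-assoc (t ∷ p) q r = begin
    (mulTerm t q ++ p *P q) *P r      ≡⟨ *P-++ˡ (mulTerm t q) (p *P q) r ⟩
    mulTerm t q *P r ++ (p *P q) *P r ≈⟨ ++-cong (≋-sym (mulTerm-*P t q r)) (*P-assoc p q r) ⟩
    mulTerm t (q *P r) ++ p *P (q *P r) ∎

  *P-[-]ʳ : (p : Poly n) (s : Carrier × Mono n) → Termwise (p *P (s ∷ [])) (mulTerm s p)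
  *P-[-]ʳ []            s       = []
  *P-[-]ʳ ((a , e) ∷ p) (b , f) = (*-comm a b , +ᵐ-comm e f) ∷ *P-[-]ʳ p (b , f)

  *P-comm : (p q : Poly n) → p *P q ≋ q *P p
  *P-comm p []      = ≡⇒≋ (*P-[]ʳ p)
  *P-comm p (s ∷ q) = begin
    p *P (s ∷ q)             ≈⟨ *P-++ʳ p (s ∷ []) q ⟩
    p *P (s ∷ []) ++ p *P q  ≈⟨ ++-cong (Termwise⇒≋ (*P-[-]ʳ p s)) (*P-comm p q) ⟩
    mulTerm s p ++ q *P p    ∎

  *P-congˡ : (p : Poly n) {q q′ : Poly n} → q ≋ q′ → p *P q ≋ p *P q′
  *P-congˡ []      _    = ≋-refl
  *P-congˡ (t ∷ p) q≋q′ = ++-cong (mulTerm-cong t q≋q′) (*P-congˡ p q≋q′)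

  *P-cong : {p p′ q q′ : Poly n} → p ≋ p′ → q ≋ q′ → p *P q ≋ p′ *P q′
  *P-cong {p = p} {p′} {q} {q′} p≋p′ q≋q′ = begin
    p *P q   ≈⟨ *P-congˡ p q≋q′ ⟩
    p *P q′  ≈⟨ *P-comm p q′ ⟩
    q′ *P p  ≈⟨ *P-congˡ q′ p≋p′ ⟩
    q′ *P p′ ≈⟨ *P-comm q′ p′ ⟩
    p′ *P q′ ∎

  *P-identityˡ : (q : Poly n) → 1P *P q ≋ q
  *P-identityˡ q = begin
    mulTerm (1# , replicate _ 0) q ++ [] ≡⟨ Listₚ.++-identityʳ _ ⟩
    mulTerm (1# , replicate _ 0) q       ≈⟨ Termwise⇒≋ (mulTerm-identity q) ⟩
    q                                    ∎

  *P-commutativeSemigroup : ℕ → CommutativeSemigroup c ℓ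
  *P-commutativeSemigroup n = record
    { Carrier = Poly n
    ; _≈_     = _≋_
    ; _∙_     = _*P_
    ; isCommutativeSemigroup = record
      { isSemigroup = record
        { isMagma = record { isEquivalence = ≋-isEquivalence ; ∙-cong = *P-cong }
        ; assoc   = *P-assoc
        }
      ; comm = *P-comm
      }
    }

  module *P-Properties {n : ℕ} = CommutativeSemigroupProperties (*P-commutativeSemigroup n)

  prodP-++ : (ps qs : List (Poly n)) → prodP (ps ++ qs) ≋ prodP ps *P prodP qs
  prodP-++ []       qs = ≋-sym (*P-identityˡ (prodP qs))
  prodP-++ (p ∷ ps) qs = ≋-trans (*P-congˡ p (prodP-++ ps qs)) (≋-sym (*P-assoc p (prodP ps) (prodP qs)))

  mapTerms-id-*P : {ε : Mono n → Mono N} → (∀ e f → ε (e +ᵐ f) ≡ ε e +ᵐ ε f) →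
                    (p q : Poly n) → mapTerms id ε (p *P q) ≡ mapTerms id ε p *P mapTerms id ε q
  mapTerms-id-*P ε-+ []            q = ≡.refl
  mapTerms-id-*P ε-+ ((a , e) ∷ p) q = ≡.trans (Listₚ.map-++ _ (mulTerm (a , e) q) (p *P q))
    (cong₂ _++_ (map-∘-commute (λ (b , f) → cong (a * b ,_) (ε-+ e f)) q) (mapTerms-id-*P ε-+ p q))

  infix 4 _∣_

  record _∣_ (q p : Poly n) : Set (c ⊔ ℓ) where
    constructor divides
    field
      quotient : Poly n
      equation : p ≋ q *P quotient

  ∣⇒∣P : {q p : Poly n} → q ∣ p → q ∣P p
  ∣⇒∣P (divides w p≋qw) = w , coeff-≈ p≋qw

  ∣P⇒∣ : {q p : Poly n} → q ∣P p → q ∣ p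
  ∣P⇒∣ (w , p≈qw) = divides w (mk≋ p≈qw)

  ∣-respʳ : {q p p′ : Poly n} → q ∣ p → p ≋ p′ → q ∣ p′
  ∣-respʳ (divides w p≋qw) p≋p′ = divides w (≋-trans (≋-sym p≋p′) p≋qw)

  ∣-respˡ : {q q′ p : Poly n} → q ≋ q′ → q ∣ p → q′ ∣ p
  ∣-respˡ q≋q′ (divides w p≋qw) = divides w (≋-trans p≋qw (*P-cong q≋q′ ≋-refl))

  ∣-++ : {q p p′ : Poly n} → q ∣ p → q ∣ p′ → q ∣ p ++ p′
  ∣-++ {q = q} {p} {p′} (divides w p≋qw) (divides w′ p′≋qw′) = divides (w ++ w′) (begin
    p ++ p′            ≈⟨ ++-cong p≋qw p′≋qw′ ⟩
    q *P w ++ q *P w′  ≈⟨ *P-++ʳ q w w′ ⟨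
    q *P (w ++ w′)     ∎)

  ∣-*P : {q p : Poly n} (f : Poly n) → q ∣ p → q ∣ f *P p
  ∣-*P {q = q} {p} f (divides w p≋qw) = divides (f *P w) (begin
    f *P p        ≈⟨ *P-congˡ f p≋qw ⟩
    f *P (q *P w) ≈⟨ *P-Properties.x∙yz≈y∙xz f q w ⟩
    q *P (f *P w) ∎)

  ∣-[] : {q : Poly n} → q ∣ []
  ∣-[] {q = q} = divides [] (≡⇒≋ (≡.sym (*P-[]ʳ q)))

  ∣-sumP : {q : Poly n} {ps : List (Poly n)} → All (q ∣_) ps → q ∣ sumP ps
  ∣-sumP         []          = ∣-[]
  ∣-sumP         (q∣p ∷ q∣ps) = ∣-++ q∣p (∣-sumP q∣ps)

module Derivatives {c ℓ : Level} (K : Field c ℓ) where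
  open Field K renaming (refl to ≈-refl; sym to ≈-sym; trans to ≈-trans)
  open FieldTheory K
  open PolynomialAlgebra K
  open ≋-Reasoning

  private variable
    n m : ℕ

  updateAt-pred-suc : (e : Mono n) (k : Fin n) {x : ℕ} → lookup e k ≡ suc x →
                      updateAt (updateAt e k (λ t → t ∸ 1)) k suc ≡ e
  updateAt-pred-suc e k eₖ≡1+x = ≡.trans (Vecₚ.updateAt-updateAt k e)
    (Vecₚ.updateAt-id-local k e (≡.trans (cong (λ t → suc (t ∸ 1)) eₖ≡1+x) (≡.sym eₖ≡1+x)))

  updateAt-suc-pred : (m : Mono n) (k : Fin n) → updateAt (updateAt m k suc) k (λ t → t ∸ 1) ≡ m
  updateAt-suc-pred m k = ≡.trans (Vecₚ.updateAt-updateAt k m) (Vecₚ.updateAt-id k m)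

  coeff-∂ : (k : Fin n) (f : Poly n) (m : Mono n) →
            coeff (∂ k f) m ≈ ι (suc (lookup m k)) * coeff f (updateAt m k suc)
  coeff-∂ k []            m = ≈-sym (zeroʳ _)
  coeff-∂ k ((a , e) ∷ f) m
    with Vecₚ.≡-dec ℕ._≟_ (updateAt e k (λ t → t ∸ 1)) m | Vecₚ.≡-dec ℕ._≟_ e (updateAt m k suc)
  ... | yes _    | yes e≡m⁺ = ≈-trans (+-cong (*-congʳ (reflexive (cong ι eₖ≡1+mₖ))) (coeff-∂ k f m))
                                (≈-sym (distribˡ _ a _))
    where eₖ≡1+mₖ = ≡.trans (cong (λ x → lookup x k) e≡m⁺) (Vecₚ.lookup∘updateAt k m)
  ... | yes e⁻≡m | no  e≢m⁺ =
    ≈-trans (+-congʳ (eₖ≡0 (lookup e k) ≡.refl)) (≈-trans (+-identityˡ _) (coeff-∂ k f m))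
    where
    -- only terms with positive exponent in x_k survive differentiation
    eₖ≡0 : ∀ x → lookup e k ≡ x → ι x * a ≈ 0#
    eₖ≡0 zero    _       = zeroˡ a
    eₖ≡0 (suc x) eₖ≡1+x = ⊥-elim (e≢m⁺
      (≡.trans (≡.sym (updateAt-pred-suc e k eₖ≡1+x)) (cong (λ v → updateAt v k suc) e⁻≡m)))
  ... | no  e⁻≢m | yes e≡m⁺ =
    ⊥-elim (e⁻≢m (≡.trans (cong (λ v → updateAt v k (λ t → t ∸ 1)) e≡m⁺) (updateAt-suc-pred m k)))
  ... | no  _    | no  _    = coeff-∂ k f m

  ∂-cong : (k : Fin n) {p q : Poly n} → p ≋ q → ∂ k p ≋ ∂ k q
  ∂-cong k {p} {q} (mk≋ p≈q) = mk≋ λ m →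
    ≈-trans (coeff-∂ k p m) (≈-trans (*-congˡ (p≈q _)) (≈-sym (coeff-∂ k q m)))

  ∂-++ : (k : Fin n) (p q : Poly n) → ∂ k (p ++ q) ≡ ∂ k p ++ ∂ k q
  ∂-++ k = Listₚ.map-++ _

  iter-∂-cong : (r : ℕ) (k : Fin n) {p q : Poly n} → p ≋ q → iter r (∂ k) p ≋ iter r (∂ k) q
  iter-∂-cong zero    k p≋q = p≋q
  iter-∂-cong (suc r) k p≋q = ∂-cong k (iter-∂-cong r k p≋q)

  iter-∂-++ : (r : ℕ) (k : Fin n) (p q : Poly n) → iter r (∂ k) (p ++ q) ≡ iter r (∂ k) p ++ iter r (∂ k) q
  iter-∂-++ zero    k p q = ≡.refl
  iter-∂-++ (suc r) k p q = ≡.trans (cong (∂ k) (iter-∂-++ r k p q)) (∂-++ k (iter r (∂ k) p) _)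

  -- ∂-along (k₁ … kₘ) (r₁ … rₘ) = ∂_{k₁}^{r₁} ⋯ ∂_{kₘ}^{rₘ}, so that ∂^ a = ∂-along (allFin n) a.
  ∂-along : Vec (Fin n) m → Vec ℕ m → Poly n → Poly n
  ∂-along ks a f = Vec.foldr (λ _ → Poly _) (λ (k , r) g → iter r (∂ k) g) f (Vec.zip ks a)

  ∂-along-++ᵛ : ∀ {m m′} (ks : Vec (Fin n) m) (ks′ : Vec (Fin n) m′) a b (f : Poly n) →
                ∂-along (ks Vec.++ ks′) (a Vec.++ b) f ≡ ∂-along ks a (∂-along ks′ b f)
  ∂-along-++ᵛ []       ks′ []      b f = ≡.refl
  ∂-along-++ᵛ (k ∷ ks) ks′ (r ∷ a) b f = cong (iter r (∂ k)) (∂-along-++ᵛ ks ks′ a b f)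

  ∂-along-zeros : (ks : Vec (Fin n) m) (f : Poly n) → ∂-along ks (replicate m 0) f ≡ f
  ∂-along-zeros []       f = ≡.refl
  ∂-along-zeros (k ∷ ks) f = ∂-along-zeros ks f

  ∂-along-++ : (ks : Vec (Fin n) m) (a : Vec ℕ m) (p q : Poly n) →
               ∂-along ks a (p ++ q) ≡ ∂-along ks a p ++ ∂-along ks a q
  ∂-along-++ []       []      p q = ≡.refl
  ∂-along-++ (k ∷ ks) (r ∷ a) p q =
    ≡.trans (cong (iter r (∂ k)) (∂-along-++ ks a p q)) (iter-∂-++ r k (∂-along ks a p) _)

  ∂-along-[] : (ks : Vec (Fin n) m) (a : Vec ℕ m) → ∂-along ks a [] ≡ []
  ∂-along-[] []       []      = ≡.refl
  ∂-along-[] (k ∷ ks) (r ∷ a) = ≡.trans (cong (iter r (∂ k)) (∂-along-[] ks a)) (iter-∂-[] r)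
    where
    iter-∂-[] : ∀ r → iter r (∂ k) [] ≡ []
    iter-∂-[] zero    = ≡.refl
    iter-∂-[] (suc r) = cong (∂ k) (iter-∂-[] r)

  ∂-along-cong : (ks : Vec (Fin n) m) (a : Vec ℕ m) {p q : Poly n} → p ≋ q → ∂-along ks a p ≋ ∂-along ks a q
  ∂-along-cong []       []      p≋q = p≋q
  ∂-along-cong (k ∷ ks) (r ∷ a) p≋q = iter-∂-cong r k (∂-along-cong ks a p≋q)

  FreeOf : Fin n → Poly n → Set c
  FreeOf k = All (λ (_ , e) → lookup e k ≡ 0)

  ∂-mulTerm : (k : Fin n) (a : Carrier) (e : Mono n) → lookup e k ≡ 0 → (h : Poly n) →
              Termwise (∂ k (mulTerm (a , e) h)) (mulTerm (a , e) (∂ k h))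
  ∂-mulTerm k a e eₖ≡0 []            = []
  ∂-mulTerm k a e eₖ≡0 ((b , f) ∷ h) = (coefficient , updateAt-+ᵐ e f k _ eₖ≡0) ∷ ∂-mulTerm k a e eₖ≡0 h
    where
    coefficient : ι (lookup (e +ᵐ f) k) * (a * b) ≈ a * (ι (lookup f k) * b)
    coefficient = ≈-trans (*-congʳ (reflexive (cong ι (≡.trans (Vecₚ.lookup-zipWith ℕ._+_ k e f)
                                                              (cong (ℕ._+ lookup f k) eₖ≡0)))))
                          (CommutativeSemigroupProperties.x∙yz≈y∙xz *-commutativeSemigroup _ a b)

  ∂-*P-freeOf : (k : Fin n) {p : Poly n} → FreeOf k p → (h : Poly n) → ∂ k (p *P h) ≋ p *P ∂ k h
  ∂-*P-freeOf k {[]}          []           h = ≋-refl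
  ∂-*P-freeOf k {(a , e) ∷ p} (eₖ≡0 ∷ free) h = begin
    ∂ k (mulTerm (a , e) h ++ p *P h)         ≡⟨ ∂-++ k (mulTerm (a , e) h) (p *P h) ⟩
    ∂ k (mulTerm (a , e) h) ++ ∂ k (p *P h)   ≈⟨ ++-cong (Termwise⇒≋ (∂-mulTerm k a e eₖ≡0 h)) (∂-*P-freeOf k free h) ⟩
    mulTerm (a , e) (∂ k h) ++ p *P ∂ k h     ∎

  ∂-along-*P-freeOf : (g : Fin m → Fin n) {p : Poly n} → (∀ i → FreeOf (g i) p) →
                      (a : Vec ℕ m) (h : Poly n) →
                      ∂-along (Vec.tabulate g) a (p *P h) ≋ p *P ∂-along (Vec.tabulate g) a h
  ∂-along-*P-freeOf g     free []      h = ≋-refl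
  ∂-along-*P-freeOf g {p} free (r ∷ a) h = begin
    iter r (∂ k) (∂-along ks a (p *P h))
      ≈⟨ iter-∂-cong r k (∂-along-*P-freeOf (g ∘ Fin.suc) (free ∘ Fin.suc) a h) ⟩
    iter r (∂ k) (p *P ∂-along ks a h)   ≈⟨ iter-∂-*P r ⟩
    p *P iter r (∂ k) (∂-along ks a h)   ∎
    where
    k  = g Fin.zero
    ks = Vec.tabulate (g ∘ Fin.suc)
    iter-∂-*P : ∀ r {f} → iter r (∂ k) (p *P f) ≋ p *P iter r (∂ k) f
    iter-∂-*P zero    = ≋-refl
    iter-∂-*P (suc r) = ≋-trans (∂-cong k (iter-∂-*P r)) (∂-*P-freeOf k (free Fin.zero) _)

module Operators {c ℓ : Level} (K : Field c ℓ) where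
  open FieldTheory K
  open PolynomialAlgebra K
  open Derivatives K
  open ≋-Reasoning

  private variable
    n : ℕ

  act-cong : (θ : Op n) {p q : Poly n} → p ≋ q → act θ p ≋ act θ q
  act-cong []            p≋q = ≋-refl
  act-cong ((r , a) ∷ θ) p≋q = ++-cong (*P-congˡ r (∂-along-cong (Vec.allFin _) a p≋q)) (act-cong θ p≋q)

  act-++ : (θ : Op n) (p q : Poly n) → act θ (p ++ q) ≋ act θ p ++ act θ q
  act-++ []            p q = ≋-refl
  act-++ ((r , a) ∷ θ) p q = begin
    r *P ∂^ a (p ++ q) ++ act θ (p ++ q)
      ≈⟨ ++-cong (≋-trans (≡⇒≋ (cong (r *P_) (∂-along-++ (Vec.allFin _) a p q))) (*P-++ʳ r (∂^ a p) (∂^ a q)))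
                 (act-++ θ p q) ⟩
    (r *P ∂^ a p ++ r *P ∂^ a q) ++ (act θ p ++ act θ q) ≈⟨ ++-interchange (r *P ∂^ a p) _ (act θ p) _ ⟩
    (r *P ∂^ a p ++ act θ p) ++ (r *P ∂^ a q ++ act θ q) ∎

  act-[] : (θ : Op n) → act θ [] ≡ []
  act-[] []            = ≡.refl
  act-[] ((r , a) ∷ θ) =
    cong₂ _++_ (≡.trans (cong (r *P_) (∂-along-[] (Vec.allFin _) a)) (*P-[]ʳ r)) (act-[] θ)

  act-++ᵒ : (θ θ′ : Op n) (g : Poly n) → act (θ ++ θ′) g ≡ act θ g ++ act θ′ g
  act-++ᵒ θ θ′ g =
    ≡.trans (cong concat (Listₚ.map-++ term θ θ′)) (≡.sym (Listₚ.concat-++ (map term θ) (map term θ′)))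
    where term = λ (r , a) → r *P ∂^ a g

  _·ᵒ_ : Poly n → Op n → Op n
  f ·ᵒ θ = map (λ (r , a) → (f *P r , a)) θ

  act-·ᵒ : (f : Poly n) (θ : Op n) (g : Poly n) → act (f ·ᵒ θ) g ≋ f *P act θ g
  act-·ᵒ f []            g = ≡⇒≋ (≡.sym (*P-[]ʳ f))
  act-·ᵒ f ((r , a) ∷ θ) g = begin
    (f *P r) *P ∂^ a g ++ act (f ·ᵒ θ) g ≈⟨ ++-cong (*P-assoc f r (∂^ a g)) (act-·ᵒ f θ g) ⟩
    f *P (r *P ∂^ a g) ++ f *P act θ g   ≈⟨ *P-++ʳ f (r *P ∂^ a g) (act θ g) ⟨
    f *P (r *P ∂^ a g ++ act θ g)        ∎

  IsOrder-·ᵒ : {i : ℕ} (f : Poly n) {θ : Op n} → IsOrder i θ → IsOrder i (f ·ᵒ θ)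
  IsOrder-·ᵒ f hθ = Allₚ.map⁺ hθ

module Product {c ℓ : Level} (K : Field c ℓ) (n₁ n₂ : ℕ) where
  open Field K renaming (refl to ≈-refl; sym to ≈-sym; trans to ≈-trans)
  open FieldTheory K
  open PolynomialAlgebra K
  open Derivatives K
  open Operators K
  open ≋-Reasoning

  private
    N : ℕ
    N = n₁ ℕ.+ n₂
    eL : Poly n₁ → Poly N
    eL = embL n₂
    eR : Poly n₂ → Poly N
    eR = embR n₁
    0₁ : Mono n₁
    0₁ = replicate n₁ 0
    0₂ : Mono n₂
    0₂ = replicate n₂ 0

  embL-cong : {p q : Poly n₁} → p ≋ q → eL p ≋ eL q
  embL-cong = MapTerms.mapTerms-cong id (Vec._++ 0₂) id ≈-refl (λ _ _ → ≈-refl) (Vec.take n₁) (λ u → take-++ u 0₂)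

  embR-cong : {p q : Poly n₂} → p ≋ q → eR p ≋ eR q
  embR-cong = MapTerms.mapTerms-cong id (0₁ Vec.++_) id ≈-refl (λ _ _ → ≈-refl) (Vec.drop n₁) (drop-++ 0₁)

  embL-*P : (p q : Poly n₁) → eL (p *P q) ≡ eL p *P eL q
  embL-*P = mapTerms-id-*P λ e f →
    ≡.trans (cong ((e +ᵐ f) Vec.++_) (≡.sym (+ᵐ-identityʳ 0₂))) (≡.sym (+ᵐ-++ e 0₂ f 0₂))

  embR-*P : (p q : Poly n₂) → eR (p *P q) ≡ eR p *P eR q
  embR-*P = mapTerms-id-*P λ e f →
    ≡.trans (cong (Vec._++ (e +ᵐ f)) (≡.sym (+ᵐ-identityʳ 0₁))) (≡.sym (+ᵐ-++ 0₁ e 0₁ f))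

  embL-freeOf : (i : Fin n₂) (p : Poly n₁) → FreeOf (n₁ ↑ʳ i) (eL p)
  embL-freeOf i p = Allₚ.map⁺ (All.universal (λ (_ , e) →
    ≡.trans (Vecₚ.lookup-++ʳ e 0₂ i) (Vecₚ.lookup-replicate i 0)) p)

  embR-freeOf : (i : Fin n₁) (q : Poly n₂) → FreeOf (i ↑ˡ n₂) (eR q)
  embR-freeOf i q = Allₚ.map⁺ (All.universal (λ (_ , e) →
    ≡.trans (Vecₚ.lookup-++ˡ 0₁ e i) (Vecₚ.lookup-replicate i 0)) q)

  ∂-embL : (i : Fin n₁) (p : Poly n₁) → ∂ (i ↑ˡ n₂) (eL p) ≡ eL (∂ i p)
  ∂-embL i = map-∘-commute λ (a , e) →
    cong₂ _,_ (cong (λ x → ι x * a) (Vecₚ.lookup-++ˡ e 0₂ i)) (updateAt-↑ˡ e 0₂ i _)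

  ∂-embR : (i : Fin n₂) (q : Poly n₂) → ∂ (n₁ ↑ʳ i) (eR q) ≡ eR (∂ i q)
  ∂-embR i = map-∘-commute λ (a , e) →
    cong₂ _,_ (cong (λ x → ι x * a) (Vecₚ.lookup-++ʳ 0₁ e i)) (updateAt-↑ʳ 0₁ e i _)

  ∂-along-embL : ∀ {m} (g : Fin m → Fin n₁) (a : Vec ℕ m) (p : Poly n₁) →
                 ∂-along (Vec.tabulate ((_↑ˡ n₂) ∘ g)) a (eL p) ≡ eL (∂-along (Vec.tabulate g) a p)
  ∂-along-embL g []      p = ≡.refl
  ∂-along-embL g (r ∷ a) p = ≡.trans (cong (iter r (∂ _)) (∂-along-embL (g ∘ Fin.suc) a p)) (iter-∂-embL r)
    where
    iter-∂-embL : ∀ r {p} → iter r (∂ (g Fin.zero ↑ˡ n₂)) (eL p) ≡ eL (iter r (∂ (g Fin.zero)) p)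
    iter-∂-embL zero    = ≡.refl
    iter-∂-embL (suc r) = ≡.trans (cong (∂ _) (iter-∂-embL r)) (∂-embL (g Fin.zero) _)

  ∂-along-embR : ∀ {m} (g : Fin m → Fin n₂) (b : Vec ℕ m) (q : Poly n₂) →
                 ∂-along (Vec.tabulate ((n₁ ↑ʳ_) ∘ g)) b (eR q) ≡ eR (∂-along (Vec.tabulate g) b q)
  ∂-along-embR g []      q = ≡.refl
  ∂-along-embR g (r ∷ b) q = ≡.trans (cong (iter r (∂ _)) (∂-along-embR (g ∘ Fin.suc) b q)) (iter-∂-embR r)
    where
    iter-∂-embR : ∀ r {q} → iter r (∂ (n₁ ↑ʳ g Fin.zero)) (eR q) ≡ eR (iter r (∂ (g Fin.zero)) q)
    iter-∂-embR zero    = ≡.refl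
    iter-∂-embR (suc r) = ≡.trans (cong (∂ _) (iter-∂-embR r)) (∂-embR (g Fin.zero) _)

  ∂ₓ : Vec ℕ n₁ → Poly N → Poly N
  ∂ₓ = ∂-along (Vec.tabulate (_↑ˡ n₂))

  ∂ᵧ : Vec ℕ n₂ → Poly N → Poly N
  ∂ᵧ = ∂-along (Vec.tabulate (n₁ ↑ʳ_))

  ∂^-split : (a : Vec ℕ n₁) (b : Vec ℕ n₂) (h : Poly N) → ∂^ (a Vec.++ b) h ≡ ∂ₓ a (∂ᵧ b h)
  ∂^-split a b h = ≡.trans (cong (λ ks → ∂-along ks (a Vec.++ b) h) (Vec-tabulate-+ n₁ id))
                           (∂-along-++ᵛ (Vec.tabulate (_↑ˡ n₂)) _ a b h)

  ∂^≡∂ₓ : (a : Vec ℕ n₁) (h : Poly N) → ∂^ (a Vec.++ 0₂) h ≡ ∂ₓ a h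
  ∂^≡∂ₓ a h = ≡.trans (∂^-split a 0₂ h) (cong (∂ₓ a) (∂-along-zeros (Vec.tabulate (n₁ ↑ʳ_)) h))

  ∂^≡∂ᵧ : (b : Vec ℕ n₂) (h : Poly N) → ∂^ (0₁ Vec.++ b) h ≡ ∂ᵧ b h
  ∂^≡∂ᵧ b h = ≡.trans (∂^-split 0₁ b h) (∂-along-zeros (Vec.tabulate (_↑ˡ n₂)) (∂ᵧ b h))

  ∂ₓ-*P-embR : (a : Vec ℕ n₁) (q : Poly n₂) (h : Poly N) → ∂ₓ a (eR q *P h) ≋ eR q *P ∂ₓ a h
  ∂ₓ-*P-embR a q h = ∂-along-*P-freeOf (_↑ˡ n₂) {eR q} (λ i → embR-freeOf i q) a h

  ∂ᵧ-*P-embL : (b : Vec ℕ n₂) (p : Poly n₁) (h : Poly N) → ∂ᵧ b (eL p *P h) ≋ eL p *P ∂ᵧ b h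
  ∂ᵧ-*P-embL b p h = ∂-along-*P-freeOf (n₁ ↑ʳ_) {eL p} (λ i → embL-freeOf i p) b h

  act-opR-embL*embR : (η : Op n₂) (A : Poly n₁) (B : Poly n₂) →
                      act (opR n₁ η) (eL A *P eR B) ≋ eL A *P eR (act η B)
  act-opR-embL*embR []            A B = ≡⇒≋ (≡.sym (*P-[]ʳ (eL A)))
  act-opR-embL*embR ((q , b) ∷ η) A B = begin
    eR q *P ∂^ (0₁ Vec.++ b) (eL A *P eR B) ++ act (opR n₁ η) (eL A *P eR B)
      ≈⟨ ++-cong (*P-congˡ (eR q) ∂ᵧ-term) (act-opR-embL*embR η A B) ⟩
    eR q *P (eL A *P eR (∂^ b B)) ++ eL A *P eR (act η B)
      ≈⟨ ++-cong (*P-Properties.x∙yz≈y∙xz (eR q) (eL A) _) ≋-refl ⟩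
    eL A *P (eR q *P eR (∂^ b B)) ++ eL A *P eR (act η B)
      ≈⟨ *P-++ʳ (eL A) _ _ ⟨
    eL A *P (eR q *P eR (∂^ b B) ++ eR (act η B))
      ≡⟨ cong (λ x → eL A *P (x ++ eR (act η B))) (embR-*P q (∂^ b B)) ⟨
    eL A *P (eR (q *P ∂^ b B) ++ eR (act η B))
      ≡⟨ cong (eL A *P_) (Listₚ.map-++ _ (q *P ∂^ b B) (act η B)) ⟨
    eL A *P eR (q *P ∂^ b B ++ act η B) ∎
    where
    ∂ᵧ-term : ∂^ (0₁ Vec.++ b) (eL A *P eR B) ≋ eL A *P eR (∂^ b B)
    ∂ᵧ-term = begin
      ∂^ (0₁ Vec.++ b) (eL A *P eR B) ≡⟨ ∂^≡∂ᵧ b (eL A *P eR B) ⟩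
      ∂ᵧ b (eL A *P eR B)             ≈⟨ ∂ᵧ-*P-embL b A (eR B) ⟩
      eL A *P ∂ᵧ b (eR B)             ≡⟨ cong (eL A *P_) (∂-along-embR id b B) ⟩
      eL A *P eR (∂^ b B)             ∎

  act-opL-embR*embL : (θ : Op n₁) (B : Poly n₂) (A : Poly n₁) →
                      act (opL n₂ θ) (eR B *P eL A) ≋ eR B *P eL (act θ A)
  act-opL-embR*embL []            B A = ≡⇒≋ (≡.sym (*P-[]ʳ (eR B)))
  act-opL-embR*embL ((p , a) ∷ θ) B A = begin
    eL p *P ∂^ (a Vec.++ 0₂) (eR B *P eL A) ++ act (opL n₂ θ) (eR B *P eL A)
      ≈⟨ ++-cong (*P-congˡ (eL p) ∂ₓ-term) (act-opL-embR*embL θ B A) ⟩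
    eL p *P (eR B *P eL (∂^ a A)) ++ eR B *P eL (act θ A)
      ≈⟨ ++-cong (*P-Properties.x∙yz≈y∙xz (eL p) (eR B) _) ≋-refl ⟩
    eR B *P (eL p *P eL (∂^ a A)) ++ eR B *P eL (act θ A)
      ≈⟨ *P-++ʳ (eR B) _ _ ⟨
    eR B *P (eL p *P eL (∂^ a A) ++ eL (act θ A))
      ≡⟨ cong (λ x → eR B *P (x ++ eL (act θ A))) (embL-*P p (∂^ a A)) ⟨
    eR B *P (eL (p *P ∂^ a A) ++ eL (act θ A))
      ≡⟨ cong (eR B *P_) (Listₚ.map-++ _ (p *P ∂^ a A) (act θ A)) ⟨
    eR B *P eL (p *P ∂^ a A ++ act θ A) ∎
    where
    ∂ₓ-term : ∂^ (a Vec.++ 0₂) (eR B *P eL A) ≋ eR B *P eL (∂^ a A)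
    ∂ₓ-term = begin
      ∂^ (a Vec.++ 0₂) (eR B *P eL A) ≡⟨ ∂^≡∂ₓ a (eR B *P eL A) ⟩
      ∂ₓ a (eR B *P eL A)             ≈⟨ ∂ₓ-*P-embR a B (eL A) ⟩
      eR B *P ∂ₓ a (eL A)             ≡⟨ cong (eR B *P_) (∂-along-embL id a A) ⟩
      eR B *P eL (∂^ a A)             ∎

  act⊗ : Op n₁ → Op n₂ → Poly N → Poly N
  act⊗ θ η h = act (opL n₂ θ) (act (opR n₁ η) h)

  act⊗-cong : (θ : Op n₁) (η : Op n₂) {p q : Poly N} → p ≋ q → act⊗ θ η p ≋ act⊗ θ η q
  act⊗-cong θ η = act-cong (opL n₂ θ) ∘ act-cong (opR n₁ η)

  act⊗-++ : (θ : Op n₁) (η : Op n₂) (p q : Poly N) → act⊗ θ η (p ++ q) ≋ act⊗ θ η p ++ act⊗ θ η q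
  act⊗-++ θ η p q = ≋-trans (act-cong (opL n₂ θ) (act-++ (opR n₁ η) p q)) (act-++ (opL n₂ θ) _ _)

  act⊗-[] : (θ : Op n₁) (η : Op n₂) → act⊗ θ η [] ≡ []
  act⊗-[] θ η = ≡.trans (cong (act (opL n₂ θ)) (act-[] (opR n₁ η))) (act-[] (opL n₂ θ))

  act⊗-embL*embR : (θ : Op n₁) (η : Op n₂) (A : Poly n₁) (B : Poly n₂) →
                   act⊗ θ η (eL A *P eR B) ≋ eL (act θ A) *P eR (act η B)
  act⊗-embL*embR θ η A B = begin
    act (opL n₂ θ) (act (opR n₁ η) (eL A *P eR B)) ≈⟨ act-cong (opL n₂ θ) (act-opR-embL*embR η A B) ⟩
    act (opL n₂ θ) (eL A *P eR (act η B))          ≈⟨ act-cong (opL n₂ θ) (*P-comm (eL A) _) ⟩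
    act (opL n₂ θ) (eR (act η B) *P eL A)          ≈⟨ act-opL-embR*embL θ (act η B) A ⟩
    eR (act η B) *P eL (act θ A)                   ≈⟨ *P-comm _ (eL (act θ A)) ⟩
    eL (act θ A) *P eR (act η B)                   ∎

  infixl 7 _⊗_

  _⊗ᵗ_ : Poly n₁ × Vec ℕ n₁ → Op n₂ → Op N
  (p , a) ⊗ᵗ η = map (λ (q , b) → (eL p *P eR q , a Vec.++ b)) η

  _⊗_ : Op n₁ → Op n₂ → Op N
  θ ⊗ η = concatMap (_⊗ᵗ η) θ

  ∂ₓ-∂ᵧ-*P-embR : (a : Vec ℕ n₁) (q : Poly n₂) (b : Vec ℕ n₂) (g : Poly N) →
                  ∂^ (a Vec.++ 0₂) (eR q *P ∂^ (0₁ Vec.++ b) g) ≋ eR q *P ∂^ (a Vec.++ b) g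
  ∂ₓ-∂ᵧ-*P-embR a q b g = begin
    ∂^ (a Vec.++ 0₂) (eR q *P ∂^ (0₁ Vec.++ b) g)
      ≡⟨ ≡.trans (∂^≡∂ₓ a _) (cong (λ x → ∂ₓ a (eR q *P x)) (∂^≡∂ᵧ b g)) ⟩
    ∂ₓ a (eR q *P ∂ᵧ b g)                         ≈⟨ ∂ₓ-*P-embR a q (∂ᵧ b g) ⟩
    eR q *P ∂ₓ a (∂ᵧ b g)                         ≡⟨ cong (eR q *P_) (∂^-split a b g) ⟨
    eR q *P ∂^ (a Vec.++ b) g                     ∎

  act-⊗ᵗ : (p : Poly n₁) (a : Vec ℕ n₁) (η : Op n₂) (g : Poly N) →
           act ((p , a) ⊗ᵗ η) g ≋ eL p *P ∂^ (a Vec.++ 0₂) (act (opR n₁ η) g)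
  act-⊗ᵗ p a [] g =
    ≡⇒≋ (≡.sym (≡.trans (cong (eL p *P_) (∂-along-[] (Vec.allFin N) (a Vec.++ 0₂))) (*P-[]ʳ (eL p))))
  act-⊗ᵗ p a ((q , b) ∷ η) g = begin
    (eL p *P eR q) *P ∂^ (a Vec.++ b) g ++ act ((p , a) ⊗ᵗ η) g
      ≈⟨ ++-cong (*P-assoc (eL p) (eR q) _) (act-⊗ᵗ p a η g) ⟩
    eL p *P (eR q *P ∂^ (a Vec.++ b) g) ++ eL p *P ∂^ (a Vec.++ 0₂) Y
      ≈⟨ ++-cong (*P-congˡ (eL p) (∂ₓ-∂ᵧ-*P-embR a q b g)) ≋-refl ⟨
    eL p *P ∂^ (a Vec.++ 0₂) X ++ eL p *P ∂^ (a Vec.++ 0₂) Y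
      ≈⟨ *P-++ʳ (eL p) _ _ ⟨
    eL p *P (∂^ (a Vec.++ 0₂) X ++ ∂^ (a Vec.++ 0₂) Y)
      ≡⟨ cong (eL p *P_) (∂-along-++ (Vec.allFin N) (a Vec.++ 0₂) X Y) ⟨
    eL p *P ∂^ (a Vec.++ 0₂) (X ++ Y) ∎
    where
    X = eR q *P ∂^ (0₁ Vec.++ b) g
    Y = act (opR n₁ η) g

  act-⊗ : (θ : Op n₁) (η : Op n₂) (g : Poly N) → act (θ ⊗ η) g ≋ act⊗ θ η g
  act-⊗ []            η g = ≋-refl
  act-⊗ ((p , a) ∷ θ) η g = begin
    act ((p , a) ⊗ᵗ η ++ θ ⊗ η) g          ≡⟨ act-++ᵒ ((p , a) ⊗ᵗ η) (θ ⊗ η) g ⟩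
    act ((p , a) ⊗ᵗ η) g ++ act (θ ⊗ η) g  ≈⟨ ++-cong (act-⊗ᵗ p a η g) (act-⊗ θ η g) ⟩
    act⊗ ((p , a) ∷ θ) η g                 ∎

  IsOrder-⊗ : {i j : ℕ} {θ : Op n₁} {η : Op n₂} → IsOrder i θ → IsOrder j η → IsOrder (i ℕ.+ j) (θ ⊗ η)
  IsOrder-⊗ {i} {j} {η = η} oθ oη = Allₚ.concat⁺ (Allₚ.map⁺ (All.map (λ {t} → IsOrder-⊗ᵗ {t}) oθ))
    where
    IsOrder-⊗ᵗ : {t : Poly n₁ × Vec ℕ n₁} → ∣ proj₂ t ∣ ≡ i → IsOrder (i ℕ.+ j) (t ⊗ᵗ η)
    IsOrder-⊗ᵗ {_ , a} ∣a∣≡i =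
      Allₚ.map⁺ (All.map (λ ∣b∣≡j → ≡.trans (Vecₚ.sum-++ a) (cong₂ ℕ._+_ ∣a∣≡i ∣b∣≡j)) oη)

  unitVec-↑ˡ : (i : Fin n₁) → unitVec (i ↑ˡ n₂) ≡ unitVec i Vec.++ 0₂
  unitVec-↑ˡ i = ≡.trans (cong (λ z → updateAt z (i ↑ˡ n₂) _) (replicate-+ n₁ n₂ 0)) (updateAt-↑ˡ 0₁ 0₂ i _)

  unitVec-↑ʳ : (i : Fin n₂) → unitVec (n₁ ↑ʳ i) ≡ 0₁ Vec.++ unitVec i
  unitVec-↑ʳ i = ≡.trans (cong (λ z → updateAt z (n₁ ↑ʳ i) _) (replicate-+ n₁ n₂ 0)) (updateAt-↑ʳ 0₁ 0₂ i _)

  linPoly-++ : (α : LinForm n₁) (β : LinForm n₂) → linPoly (α Vec.++ β) ≡ eL (linPoly α) ++ eR (linPoly β)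
  linPoly-++ α β = ≡.trans (cong (map term) (allFin-+ n₁ n₂))
    (≡.trans (Listₚ.map-++ term (map (_↑ˡ n₂) (List.allFin n₁)) (map (n₁ ↑ʳ_) (List.allFin n₂)))
    (cong₂ _++_ (map-∘-commute (λ i → cong₂ _,_ (Vecₚ.lookup-++ˡ α β i) (unitVec-↑ˡ i)) (List.allFin n₁))
                (map-∘-commute (λ i → cong₂ _,_ (Vecₚ.lookup-++ʳ α β i) (unitVec-↑ʳ i)) (List.allFin n₂))))
    where term = λ k → (lookup (α Vec.++ β) k , unitVec k)

  linPoly-zeros : ∀ {n} → linPoly (replicate n 0#) ≋ []
  linPoly-zeros = zero-coeffs⇒≋[] (Allₚ.map⁺ (All.universal (λ k → reflexive (Vecₚ.lookup-replicate k 0#)) _))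

  Q-embL : (αs : List (LinForm n₁)) → Q (map (λ α → α Vec.++ replicate n₂ 0#) αs) ≋ eL (Q αs)
  Q-embL []       = ≡⇒≋ (cong (λ e → (1# , e) ∷ []) (replicate-+ n₁ n₂ 0))
  Q-embL (α ∷ αs) = begin
    linPoly (α Vec.++ replicate n₂ 0#) *P Q (map (λ α → α Vec.++ replicate n₂ 0#) αs)
      ≈⟨ *P-cong linPoly-αs≋ (Q-embL αs) ⟩
    eL (linPoly α) *P eL (Q αs) ≡⟨ embL-*P (linPoly α) (Q αs) ⟨
    eL (linPoly α *P Q αs)      ∎
    where
    linPoly-αs≋ : linPoly (α Vec.++ replicate n₂ 0#) ≋ eL (linPoly α)
    linPoly-αs≋ = begin
      linPoly (α Vec.++ replicate n₂ 0#)           ≡⟨ linPoly-++ α (replicate n₂ 0#) ⟩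
      eL (linPoly α) ++ eR (linPoly (replicate n₂ 0#)) ≈⟨ ++-cong ≋-refl (embR-cong linPoly-zeros) ⟩
      eL (linPoly α) ++ []                          ≡⟨ Listₚ.++-identityʳ _ ⟩
      eL (linPoly α)                                ∎

  Q-embR : (βs : List (LinForm n₂)) → Q (map (λ β → replicate n₁ 0# Vec.++ β) βs) ≋ eR (Q βs)
  Q-embR []       = ≡⇒≋ (cong (λ e → (1# , e) ∷ []) (replicate-+ n₁ n₂ 0))
  Q-embR (β ∷ βs) = begin
    linPoly (replicate n₁ 0# Vec.++ β) *P Q (map (λ β → replicate n₁ 0# Vec.++ β) βs)
      ≈⟨ *P-cong linPoly-βs≋ (Q-embR βs) ⟩
    eR (linPoly β) *P eR (Q βs) ≡⟨ embR-*P (linPoly β) (Q βs) ⟨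
    eR (linPoly β *P Q βs)      ∎
    where
    linPoly-βs≋ : linPoly (replicate n₁ 0# Vec.++ β) ≋ eR (linPoly β)
    linPoly-βs≋ = begin
      linPoly (replicate n₁ 0# Vec.++ β)               ≡⟨ linPoly-++ (replicate n₁ 0#) β ⟩
      eL (linPoly (replicate n₁ 0#)) ++ eR (linPoly β) ≈⟨ ++-cong (embL-cong linPoly-zeros) ≋-refl ⟩
      eR (linPoly β)                                   ∎

  Q-formsProd : (αs : List (LinForm n₁)) (βs : List (LinForm n₂)) → Q (formsProd αs βs) ≋ eL (Q αs) *P eR (Q βs)
  Q-formsProd αs βs = begin
    Q (formsProd αs βs)          ≡⟨ cong prodP (Listₚ.map-++ linPoly αs′ βs′) ⟩
    prodP (map linPoly αs′ ++ map linPoly βs′) ≈⟨ prodP-++ (map linPoly αs′) (map linPoly βs′) ⟩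
    Q αs′ *P Q βs′               ≈⟨ *P-cong (Q-embL αs) (Q-embR βs) ⟩
    eL (Q αs) *P eR (Q βs)       ∎
    where
    αs′ = map (λ α → α Vec.++ replicate n₂ 0#) αs
    βs′ = map (λ β → replicate n₁ 0# Vec.++ β) βs

  term-embL*embR : (a : Carrier) (u : Mono n₁) (v : Mono n₂) →
                   (a , u Vec.++ v) ∷ [] ≋ eL ((a , u) ∷ []) *P eR ((1# , v) ∷ [])
  term-embL*embR a u v = Termwise⇒≋ ((≈-sym (*-identityʳ a) , ≡.sym exponent) ∷ [])
    where
    exponent : (u Vec.++ 0₂) +ᵐ (0₁ Vec.++ v) ≡ u Vec.++ v
    exponent = ≡.trans (+ᵐ-++ u 0₂ 0₁ v) (cong₂ Vec._++_ (+ᵐ-identityʳ u) (+ᵐ-identityˡ v))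

  act⊗-preserves-product : (θ : Op n₁) (η : Op n₂) {Q₁ A : Poly n₁} {Q₂ B : Poly n₂} →
                           Q₁ ∣ act θ (Q₁ *P A) → Q₂ ∣ act η (Q₂ *P B) →
                           eL Q₁ *P eR Q₂ ∣ act⊗ θ η ((eL Q₁ *P eR Q₂) *P (eL A *P eR B))
  act⊗-preserves-product θ η {Q₁} {A} {Q₂} {B} (divides w₁ θQ₁A≋Q₁w₁) (divides w₂ ηQ₂B≋Q₂w₂) =
    divides (eL w₁ *P eR w₂) (begin
      act⊗ θ η ((eL Q₁ *P eR Q₂) *P (eL A *P eR B)) ≈⟨ act⊗-cong θ η (*P-Properties.interchange (eL Q₁) _ _ _) ⟩
      act⊗ θ η ((eL Q₁ *P eL A) *P (eR Q₂ *P eR B))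
        ≡⟨ cong₂ (λ x y → act⊗ θ η (x *P y)) (embL-*P Q₁ A) (embR-*P Q₂ B) ⟨
      act⊗ θ η (eL (Q₁ *P A) *P eR (Q₂ *P B))       ≈⟨ act⊗-embL*embR θ η (Q₁ *P A) (Q₂ *P B) ⟩
      eL (act θ (Q₁ *P A)) *P eR (act η (Q₂ *P B))  ≈⟨ *P-cong (embL-cong θQ₁A≋Q₁w₁) (embR-cong ηQ₂B≋Q₂w₂) ⟩
      eL (Q₁ *P w₁) *P eR (Q₂ *P w₂)                ≡⟨ cong₂ _*P_ (embL-*P Q₁ w₁) (embR-*P Q₂ w₂) ⟩
      (eL Q₁ *P eL w₁) *P (eR Q₂ *P eR w₂)          ≈⟨ *P-Properties.interchange (eL Q₁) _ _ _ ⟩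
      (eL Q₁ *P eR Q₂) *P (eL w₁ *P eR w₂)          ∎)

  act⊗-preserves : (θ : Op n₁) (η : Op n₂) {Q₁ : Poly n₁} {Q₂ : Poly n₂} →
                   (∀ A → Q₁ ∣ act θ (Q₁ *P A)) → (∀ B → Q₂ ∣ act η (Q₂ *P B)) →
                   ∀ g → eL Q₁ *P eR Q₂ ∣ act⊗ θ η ((eL Q₁ *P eR Q₂) *P g)
  act⊗-preserves θ η {Q₁} {Q₂} θ-preserves η-preserves [] =
    ∣-respʳ ∣-[] (≡⇒≋ (≡.sym (≡.trans (cong (act⊗ θ η) (*P-[]ʳ (eL Q₁ *P eR Q₂)))
                                      (act⊗-[] θ η))))
  act⊗-preserves θ η {Q₁} {Q₂} θ-preserves η-preserves ((a , m) ∷ g) with Vec.splitAt n₁ m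
  ... | u , v , ≡.refl = ∣-respʳ
    (∣-++ (act⊗-preserves-product θ η (θ-preserves ((a , u) ∷ [])) (η-preserves ((1# , v) ∷ [])))
          (act⊗-preserves θ η θ-preserves η-preserves g))
    (begin
      act⊗ θ η (Q₁₂ *P (eL ((a , u) ∷ []) *P eR ((1# , v) ∷ []))) ++ act⊗ θ η (Q₁₂ *P g)
        ≈⟨ ++-cong (act⊗-cong θ η (*P-congˡ Q₁₂ (term-embL*embR a u v))) ≋-refl ⟨
      act⊗ θ η (Q₁₂ *P ((a , u Vec.++ v) ∷ [])) ++ act⊗ θ η (Q₁₂ *P g)
        ≈⟨ act⊗-++ θ η (Q₁₂ *P ((a , u Vec.++ v) ∷ [])) (Q₁₂ *P g) ⟨
      act⊗ θ η (Q₁₂ *P ((a , u Vec.++ v) ∷ []) ++ Q₁₂ *P g)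
        ≈⟨ act⊗-cong θ η (*P-++ʳ Q₁₂ ((a , u Vec.++ v) ∷ []) g) ⟨
      act⊗ θ η (Q₁₂ *P ((a , u Vec.++ v) ∷ g)) ∎)
    where Q₁₂ = eL Q₁ *P eR Q₂

  act⊗-preserves-Q : (αs : List (LinForm n₁)) (βs : List (LinForm n₂)) (θ : Op n₁) (η : Op n₂) →
                     (∀ A → Q αs ∣P act θ (Q αs *P A)) → (∀ B → Q βs ∣P act η (Q βs *P B)) →
                     ∀ g → Q (formsProd αs βs) ∣ act⊗ θ η (Q (formsProd αs βs) *P g)
  act⊗-preserves-Q αs βs θ η θ-preserves η-preserves g =
    ∣-respˡ (≋-sym Q≋)
      (∣-respʳ (act⊗-preserves θ η {Q αs} {Q βs} (∣P⇒∣ ∘ θ-preserves) (∣P⇒∣ ∘ η-preserves) g)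
               (act⊗-cong θ η (*P-cong (≋-sym Q≋) (≋-refl {x = g}))))
    where
    Q≋ : Q (formsProd αs βs) ≋ eL (Q αs) *P eR (Q βs)
    Q≋ = Q-formsProd αs βs

  combination : List (Poly N × Op n₁ × Op n₂) → Op N
  combination = concatMap (λ (f , θ , η) → f ·ᵒ (θ ⊗ η))

  act-combination : (gens : List (Poly N × Op n₁ × Op n₂)) (g : Poly N) →
                    act (combination gens) g ≋ sumP (map (λ (f , θ , η) → f *P act⊗ θ η g) gens)
  act-combination []                   g = ≋-refl
  act-combination ((f , θ , η) ∷ gens) g = begin
    act (f ·ᵒ (θ ⊗ η) ++ combination gens) g         ≡⟨ act-++ᵒ (f ·ᵒ (θ ⊗ η)) (combination gens) g ⟩
    act (f ·ᵒ (θ ⊗ η)) g ++ act (combination gens) g ≈⟨ ++-cong act-term (act-combination gens g) ⟩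
    f *P act⊗ θ η g ++ sumP (map (λ (f , θ , η) → f *P act⊗ θ η g) gens) ∎
    where act-term = ≋-trans (act-·ᵒ f (θ ⊗ η) g) (*P-congˡ f (act-⊗ θ η g))

  combination-∈D : {i j : ℕ} (αs : List (LinForm n₁)) (βs : List (LinForm n₂))
                   (gens : List (Poly N × Op n₁ × Op n₂)) →
                   All (λ (_ , θ , η) → InD i αs θ × InD j βs η) gens →
                   InD (i ℕ.+ j) (formsProd αs βs) (combination gens)
  combination-∈D αs βs gens ∈D = order , preserves
    where
    order = Allₚ.concat⁺ (Allₚ.map⁺ (All.map
      (λ {(f , θ , η)} ((oθ , _) , (oη , _)) → IsOrder-·ᵒ f (IsOrder-⊗ oθ oη)) ∈D))
    preserves : ∀ g → Q (formsProd αs βs) ∣P act (combination gens) (Q (formsProd αs βs) *P g)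
    preserves g = ∣⇒∣P (∣-respʳ
      (∣-sumP (Allₚ.map⁺ (All.map (λ {(f , θ , η)} ((_ , θ-pres) , (_ , η-pres)) →
                                      ∣-*P f (act⊗-preserves-Q αs βs θ η θ-pres η-pres g)) ∈D)))
      (≋-sym (act-combination gens _)))

open import Data.Nat using (_+_; _≤_)

lemma3p1 : {c ℓ : Level} (K : Field c ℓ) → FieldTheory.CharZero K →
    let open FieldTheory K in
    (ℓ₁ ℓ₂ : ℕ) → 1 ≤ ℓ₁ → 1 ≤ ℓ₂ →
    (A₁ : Arrangement ℓ₁) (A₂ : Arrangement ℓ₂) (i j : ℕ) →
    (gens : List (Poly (ℓ₁ + ℓ₂) × Op ℓ₁ × Op ℓ₂)) →
    All (λ { (f , θ , η) → InD i (forms A₁) θ × InD j (forms A₂) η }) gens →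
    Σ (Op (ℓ₁ + ℓ₂)) (λ Φ →
      InD (i + j) (formsProd (forms A₁) (forms A₂)) Φ ×
      (∀ g → act Φ g ≈P
        sumP (map (λ { (f , θ , η) → f *P act (opL ℓ₂ θ) (act (opR ℓ₁ η) g) }) gens)))
lemma3p1 K _ ℓ₁ ℓ₂ _ _ A₁ A₂ i j gens ∈D =
  combination gens , combination-∈D (forms A₁) (forms A₂) gens ∈D , λ g → coeff-≈ (act-combination gens g)
  where
  open FieldTheory K using (forms)
  open PolynomialAlgebra K using (coeff-≈)
  open Product K ℓ₁ ℓ₂
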